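{- Let $W$ be a finite Coxeter group, $B(W)$ its Bruhat graph, and $A\subseteq W$. Then $$|\partial A|\ge \frac12\,|A|\left(1-\frac{|A|}{|W|}\right),$$ where $\partial A$ is the set of edges of $B(W)$ connecting $A$ to its complement $W\setminus A$.
   Context: For a Coxeter system $(W,S)$ (group $W$ generated by finite $S$ with relations $(s_is_j)^{m_{ij}}=e$, $m_{ii}=1$, $m_{ij}=m_{ji}\ge 2$), $\ell$ is word length w.r.t. $S$ and $T=\bigcup_{w\in W}wSw^{ -1}$ the set of reflections. The Bruhat graph $B(W)$ has vertex set $W$, with $w,v$ adjacent iff $v=tw$ with $t\in T$ and $\ell(v)<\ell(w)$, or $w=tv$ with $t\in T$ and $\ell(w)<\ell(v)$. -}

module Defs where

open import Data.Nat using (ℕ; zero; suc; _+_; _*_; _≤_; _<?_)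
open import Data.Fin using (Fin)
open import Data.Fin.Properties using (_≟_)
open import Data.Fin.Subset using (Subset)
open import Data.Vec using (lookup)
open import Data.List using (List; []; _∷_; _++_; length; concat; replicate; foldr; map; allFin)
open import Data.Nat.ListAction using (sum)
open import Data.Bool.ListAction using (any)
open import Data.Bool using (Bool; true; false; if_then_else_; _∧_; _∨_; not)
open import Data.Product using (Σ; _×_; ∃)
open import Relation.Nullary using (¬_)
open import Relation.Nullary.Decidable using (⌊_⌋)
open import Relation.Binary.PropositionalEquality using (_≡_)
open import Algebra.Structures using (IsGroup)

-- Words in the generators s₀,…,s_{n-1} (generators are involutions in a
-- Coxeter group, so positive words suffice).
Word : ℕ → Set
Word n = List (Fin n)

relator : {n : ℕ} → (Fin n → Fin n → ℕ) → Fin n → Fin n → Word n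
relator m i j = concat (replicate (m i j) (i ∷ j ∷ []))

data _∼[_]_ {n : ℕ} : Word n → (Fin n → Fin n → ℕ) → Word n → Set where
  ∼-rel   : ∀ {m} (u v : Word n) (i j : Fin n) → (u ++ relator m i j ++ v) ∼[ m ] (u ++ v)
  ∼-refl  : ∀ {m} {u} → u ∼[ m ] u
  ∼-sym   : ∀ {m} {u v} → u ∼[ m ] v → v ∼[ m ] u
  ∼-trans : ∀ {m} {u v w} → u ∼[ m ] v → v ∼[ m ] w → u ∼[ m ] w

-- A finite Coxeter system (W,S): W is a finite group, realised on the carrier
-- Fin N with the group law given by _·_, together with generators
-- gen : Fin n → W and a Coxeter matrix m, such that W is *presented* by
-- the generators gen i and relations (s_i s_j)^{m_ij} = e.
record FiniteCoxeterSystem : Set where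
  field
    N     : ℕ
    rank  : ℕ
    m     : Fin rank → Fin rank → ℕ
    m-diag : ∀ i → m i i ≡ 1
    m-sym  : ∀ i j → m i j ≡ m j i
    m-off  : ∀ i j → ¬ (i ≡ j) → 2 ≤ m i j
    _·_   : Fin N → Fin N → Fin N
    e     : Fin N
    _⁻¹   : Fin N → Fin N
    isGroup : IsGroup _≡_ _·_ e _⁻¹
    gen   : Fin rank → Fin N
  eval : Word rank → Fin N
  eval = foldr (λ i g → gen i · g) e
  field
    generates   : ∀ (w : Fin N) → ∃ λ (u : Word rank) → eval u ≡ w
    relations   : ∀ i j → eval (relator m i j) ≡ e
    presentation : ∀ (u : Word rank) → eval u ≡ e → u ∼[ m ] []

module _ (W : FiniteCoxeterSystem) where
  open FiniteCoxeterSystem W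

  IsWordLength : (Fin N → ℕ) → Set
  IsWordLength ℓ = ∀ w →
    (∃ λ (u : Word rank) → (length u ≡ ℓ w) × (eval u ≡ w)) ×
    (∀ (u : Word rank) → eval u ≡ w → ℓ w ≤ length u)

  isReflection : Fin N → Bool
  isReflection t = any (λ g → any (λ i → ⌊ t ≟ ((g · gen i) · (g ⁻¹)) ⌋) (allFin rank)) (allFin N)

  bruhatAdj : (Fin N → ℕ) → Fin N → Fin N → Bool
  bruhatAdj ℓ w v =
    (isReflection (v · (w ⁻¹)) ∧ ⌊ ℓ v <? ℓ w ⌋) ∨
    (isReflection (w · (v ⁻¹)) ∧ ⌊ ℓ w <? ℓ v ⌋)

  -- |∂A| : number of edges {w,v} of B(W) with w ∈ A, v ∉ A
  -- (each such edge is counted exactly once, via the ordered pair (w , v))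
  boundarySize : (Fin N → ℕ) → Subset N → ℕ
  boundarySize ℓ A =
    sum (map (λ w → sum (map (λ v →
      if lookup A w ∧ not (lookup A v) ∧ bruhatAdj ℓ w v then 1 else 0)
      (allFin N))) (allFin N))

-- For a reduced word s₁⋯s_k of g the reflections t_j = s₁⋯s_{j-1} s_j s_{j-1}⋯s₁ are
-- pairwise distinct, and a is carried to g a by left multiplication with t₁, t₂, …, t_k in turn.
-- So if a ∈ A and g a ∉ A, some intermediate point y ∈ A has t_j y ∉ A.  Every pair {y, t y}
-- with t a reflection is an edge of the Bruhat graph: ℓ mod 2 is a homomorphism W → ℤ/2 (the
-- Coxeter relators have even length) under which reflections are odd, so ℓ(t y) ≠ ℓ(y).
-- Hence #{a ∈ A : g a ∉ A} ≤ |∂A| for every g, and summing over g ∈ W gives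
-- |A| (|W| − |A|) ≤ |W| |∂A|.

module Submission where

open import Algebra.Bundles using (Group)
open import Algebra.Structures using (IsGroup)
import Algebra.Properties.Group as GroupProperties
open import Data.Bool using (Bool; true; false; if_then_else_; _∧_; _∨_; not)
open import Data.Bool.Properties using (∧-identityʳ; ∧-inverseʳ; T-≡)
open import Data.Empty using (⊥-elim)
open import Data.Fin using (Fin; zero; suc)
open import Data.Fin.Permutation using (permutation)
open import Data.Fin.Properties using (_≟_)
open import Data.Fin.Subset using (Subset; ∣_∣; ∁)
open import Data.Fin.Subset.Properties using (∣∁p∣≡n∸∣p∣)
open import Data.List using (List; []; _∷_; _++_; map; allFin; tabulate; length; concat; replicate)
open import Data.List.Membership.Propositional using (lose)
open import Data.List.Membership.Propositional.Properties using (∈-allFin)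
open import Data.List.Properties
  using (map-tabulate; map-∘; map-cong; map-cong-local; length-++)
open import Data.List.Relation.Unary.All as All using (All; []; _∷_)
import Data.List.Relation.Unary.All.Properties as All
open import Data.List.Relation.Unary.AllPairs using ([]; _∷_)
open import Data.List.Relation.Unary.Any.Properties using (any⁺)
open import Data.List.Relation.Unary.Unique.Propositional using (Unique)
import Data.List.Relation.Unary.Unique.Propositional.Properties as Unique
open import Data.Nat using (ℕ; zero; suc; parity; _+_; _*_; _∸_; _≤_; _<_; z≤n; s≤s; s≤s⁻¹; _<?_)
open import Data.Nat.ListAction using (sum)
open import Data.Nat.Properties
  using ( +-*-semiring; +-mono-≤; +-monoʳ-≤; +-identityʳ; *-identityˡ; *-distribʳ-+
        ; *-monoˡ-≤; *-comm; m≤m+n; ≤-reflexive; ≤-antisym; ≮⇒≥; <⇒≱; n<1+n; m<n⇒m<1+n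
        ; module ≤-Reasoning)
open import Data.Parity using (Parity; 0ℙ; 1ℙ) renaming (_+_ to _+ℙ_; _⁻¹ to _⁻¹ℙ)
import Data.Parity.Properties as ℙ
open import Data.Product using (∃; ∃₂; _×_; _,_; proj₁; proj₂)
open import Data.Vec using (lookup; []; _∷_)
open import Data.Vec.Properties using (lookup-map)
open import Function using (_∘_)
open import Function.Bundles using (Equivalence)
open import Level using (0ℓ)
open import Relation.Binary.PropositionalEquality
open import Relation.Nullary using (yes; no; does)
open import Relation.Nullary.Decidable using (⌊_⌋; dec-false; fromWitness)
open import Algebra.Properties.Semiring.Sum +-*-semiring
  using (sum-syntax; ∑-distrib-+; ∑-comm; sum-replicate-zero; sum-cong-≗; sum-permute;
         *-distribˡ-sum; *-distribʳ-sum)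

open import Defs

𝟙[_] : Bool → ℕ
𝟙[ b ] = if b then 1 else 0

𝟙[∧] : ∀ a b → 𝟙[ a ∧ b ] ≡ 𝟙[ a ] * 𝟙[ b ]
𝟙[∧] true  b = sym (*-identityˡ 𝟙[ b ])
𝟙[∧] false b = refl

𝟙[∧not]-trans : ∀ a b c → 𝟙[ a ∧ not c ] ≤ 𝟙[ a ∧ not b ] + 𝟙[ b ∧ not c ]
𝟙[∧not]-trans true  true  c     = ≤-reflexive refl
𝟙[∧not]-trans true  false true  = z≤n
𝟙[∧not]-trans true  false false = s≤s z≤n
𝟙[∧not]-trans false b     c     = z≤n

∑-mono-≤ : ∀ {n} {f g : Fin n → ℕ} → (∀ i → f i ≤ g i) → ∑[ i < n ] f i ≤ ∑[ i < n ] g i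
∑-mono-≤ {zero}  f≤g = z≤n
∑-mono-≤ {suc n} f≤g = +-mono-≤ (f≤g zero) (∑-mono-≤ (f≤g ∘ suc))

∑-const : ∀ n c → ∑[ i < n ] c ≡ n * c
∑-const zero    c = refl
∑-const (suc n) c = cong (c +_) (∑-const n c)

∑-bijection : ∀ {n} (f f⁻¹ : Fin n → Fin n) →
  (∀ x → f (f⁻¹ x) ≡ x) → (∀ x → f⁻¹ (f x) ≡ x) → (h : Fin n → ℕ) → ∑[ x < n ] h (f x) ≡ ∑[ x < n ] h x
∑-bijection f f⁻¹ ff⁻¹ f⁻¹f h = sym (sum-permute h (permutation f f⁻¹ ff⁻¹ f⁻¹f))

sum-tabulate : ∀ {n} (f : Fin n → ℕ) → sum (tabulate f) ≡ ∑[ i < n ] f i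
sum-tabulate {zero}  f = refl
sum-tabulate {suc n} f = cong (f zero +_) (sum-tabulate (f ∘ suc))

sum-map-allFin : ∀ {n} (f : Fin n → ℕ) → sum (map f (allFin n)) ≡ ∑[ i < n ] f i
sum-map-allFin f = trans (cong sum (map-tabulate (λ i → i) f)) (sum-tabulate f)

sum-map-∑-comm : ∀ {A : Set} {n} (φ : A → Fin n → ℕ) (xs : List A) →
  sum (map (λ x → ∑[ i < n ] φ x i) xs) ≡ ∑[ i < n ] sum (map (λ x → φ x i) xs)
sum-map-∑-comm {n = n} φ []       = sym (sum-replicate-zero n)
sum-map-∑-comm         φ (x ∷ xs) =
  trans (cong (∑[ i < _ ] φ x i +_) (sum-map-∑-comm φ xs)) (sym (∑-distrib-+ (φ x) _))

multiplicity : ∀ {n} → Fin n → List (Fin n) → ℕ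
multiplicity x xs = sum (map (λ y → 𝟙[ does (x ≟ y) ]) xs)

∑-𝟙[≟]* : ∀ {n} (y : Fin n) (h : Fin n → ℕ) → ∑[ x < n ] (𝟙[ does (x ≟ y) ] * h x) ≡ h y
∑-𝟙[≟]* {suc n} zero    h =
  trans (cong₂ _+_ (*-identityˡ (h zero)) (sum-replicate-zero n)) (+-identityʳ (h zero))
∑-𝟙[≟]* {suc n} (suc y) h = ∑-𝟙[≟]* {n} y (h ∘ suc)

sum-map-multiplicity : ∀ {n} (h : Fin n → ℕ) (xs : List (Fin n)) →
  sum (map h xs) ≡ ∑[ x < n ] (multiplicity x xs * h x)
sum-map-multiplicity {n} h []       = sym (sum-replicate-zero n)
sum-map-multiplicity {n} h (y ∷ xs) = begin
  h y + sum (map h xs)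
    ≡⟨ cong₂ _+_ (sym (∑-𝟙[≟]* y h)) (sum-map-multiplicity h xs) ⟩
  ∑[ x < n ] (𝟙[ does (x ≟ y) ] * h x) + ∑[ x < n ] (multiplicity x xs * h x)
    ≡⟨ sym (∑-distrib-+ (λ x → 𝟙[ does (x ≟ y) ] * h x) (λ x → multiplicity x xs * h x)) ⟩
  ∑[ x < n ] (𝟙[ does (x ≟ y) ] * h x + multiplicity x xs * h x)
    ≡⟨ sum-cong-≗ (λ x → sym (*-distribʳ-+ (h x) 𝟙[ does (x ≟ y) ] (multiplicity x xs))) ⟩
  ∑[ x < n ] (multiplicity x (y ∷ xs) * h x) ∎
  where open ≡-Reasoning

multiplicity-∉ : ∀ {n} {x : Fin n} {xs} → All (x ≢_) xs → multiplicity x xs ≡ 0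
multiplicity-∉ []                           = refl
multiplicity-∉ {x = x} (_∷_ {y} x≢y x∉xs) =
  cong₂ _+_ (cong 𝟙[_] (dec-false (x ≟ y) x≢y)) (multiplicity-∉ x∉xs)

multiplicity≤1 : ∀ {n} (x : Fin n) {xs} → Unique xs → multiplicity x xs ≤ 1
multiplicity≤1 x []                        = z≤n
multiplicity≤1 x (_∷_ {y} y∉xs uniq) with x ≟ y
... | yes refl = ≤-reflexive (cong suc (multiplicity-∉ y∉xs))
... | no  _    = multiplicity≤1 x uniq

sum-map-≤-∑ : ∀ {n} (h : Fin n → ℕ) {xs : List (Fin n)} → Unique xs →
  sum (map h xs) ≤ ∑[ x < n ] h x
sum-map-≤-∑ {n} h {xs} uniq = begin
  sum (map h xs)
    ≡⟨ sum-map-multiplicity h xs ⟩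
  ∑[ x < n ] (multiplicity x xs * h x)
    ≤⟨ ∑-mono-≤ (λ x → *-monoˡ-≤ (h x) (multiplicity≤1 x uniq)) ⟩
  ∑[ x < n ] (1 * h x)
    ≡⟨ sum-cong-≗ (λ x → *-identityˡ (h x)) ⟩
  ∑[ x < n ] h x ∎
  where open ≤-Reasoning

≢⇒<?∨>? : ∀ {a b} → a ≢ b → (⌊ a <? b ⌋ ∨ ⌊ b <? a ⌋) ≡ true
≢⇒<?∨>? {a} {b} a≢b with a <? b | b <? a
... | yes _   | _       = refl
... | no  _   | yes _   = refl
... | no  a≮b | no  b≮a = ⊥-elim (a≢b (≤-antisym (≮⇒≥ b≮a) (≮⇒≥ a≮b)))

∣p∣≡∑𝟙 : ∀ {n} (p : Subset n) → ∣ p ∣ ≡ ∑[ i < n ] 𝟙[ lookup p i ]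
∣p∣≡∑𝟙 []            = refl
∣p∣≡∑𝟙 (true  ∷ p) = cong suc (∣p∣≡∑𝟙 p)
∣p∣≡∑𝟙 (false ∷ p) = ∣p∣≡∑𝟙 p

∑∑𝟙[inside∧outside] : ∀ {n} (p : Subset n) →
  ∑[ a < n ] ∑[ b < n ] 𝟙[ lookup p a ∧ not (lookup p b) ] ≡ ∣ p ∣ * (n ∸ ∣ p ∣)
∑∑𝟙[inside∧outside] {n} p = begin
  ∑[ a < n ] ∑[ b < n ] 𝟙[ lookup p a ∧ not (lookup p b) ]
    ≡⟨ sum-cong-≗ (λ a → sum-cong-≗ (λ b → 𝟙[∧] (lookup p a) (not (lookup p b)))) ⟩
  ∑[ a < n ] ∑[ b < n ] (𝟙[ lookup p a ] * 𝟙[ not (lookup p b) ])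
    ≡⟨ sum-cong-≗ (λ a → *-distribˡ-sum {n} 𝟙[ lookup p a ] _) ⟨
  ∑[ a < n ] (𝟙[ lookup p a ] * ∑[ b < n ] 𝟙[ not (lookup p b) ])
    ≡⟨ *-distribʳ-sum {n} _ _ ⟨
  ∑[ a < n ] 𝟙[ lookup p a ] * ∑[ b < n ] 𝟙[ not (lookup p b) ]
    ≡⟨ cong₂ _*_ (∣p∣≡∑𝟙 p) ∣∁p∣≡∑𝟙[not] ⟨
  ∣ p ∣ * ∣ ∁ p ∣
    ≡⟨ cong (∣ p ∣ *_) (∣∁p∣≡n∸∣p∣ p) ⟩
  ∣ p ∣ * (n ∸ ∣ p ∣) ∎
  where
  open ≡-Reasoning
  ∣∁p∣≡∑𝟙[not] : ∣ ∁ p ∣ ≡ ∑[ b < n ] 𝟙[ not (lookup p b) ]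
  ∣∁p∣≡∑𝟙[not] =
    trans (∣p∣≡∑𝟙 (∁ p)) (sum-cong-≗ (λ b → cong 𝟙[_] (lookup-map b not p)))

module FiniteGroup {N : ℕ} {_·_ : Fin N → Fin N → Fin N} {e : Fin N} {_⁻¹ : Fin N → Fin N}
                   (isGroup : IsGroup _≡_ _·_ e _⁻¹) where

  open IsGroup isGroup using (assoc; identityˡ; identityʳ; inverseʳ)

  group : Group 0ℓ 0ℓ
  group = record { isGroup = isGroup }

  open GroupProperties group public
    using (∙-cancelˡ; ∙-cancelʳ; inverseʳ-unique; ⁻¹-anti-homo-∙;
           \\-leftDividesˡ; \\-leftDividesʳ; //-rightDividesˡ; //-rightDividesʳ)

  ∑-translateˡ : ∀ g (h : Fin N → ℕ) → ∑[ x < N ] h (g · x) ≡ ∑[ x < N ] h x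
  ∑-translateˡ g = ∑-bijection (g ·_) ((g ⁻¹) ·_) (\\-leftDividesˡ g) (\\-leftDividesʳ g)

  ∑-translateʳ : ∀ g (h : Fin N → ℕ) → ∑[ x < N ] h (x · g) ≡ ∑[ x < N ] h x
  ∑-translateʳ g =
    ∑-bijection (_· g) (_· (g ⁻¹)) (λ x → //-rightDividesˡ g x) (λ x → //-rightDividesʳ g x)

  conjugate : Fin N → Fin N → Fin N
  conjugate g x = (g · x) · (g ⁻¹)

  conjugate-act : ∀ g x y → conjugate g x · (g · y) ≡ g · (x · y)
  conjugate-act g x y = begin
    ((g · x) · (g ⁻¹)) · (g · y)  ≡⟨ assoc (g · x) (g ⁻¹) (g · y) ⟩
    (g · x) · ((g ⁻¹) · (g · y))  ≡⟨ cong ((g · x) ·_) (\\-leftDividesʳ g y) ⟩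
    (g · x) · y                   ≡⟨ assoc g x y ⟩
    g · (x · y)                   ∎
    where open ≡-Reasoning

  conjugate-· : ∀ g h x → conjugate g (conjugate h x) ≡ conjugate (g · h) x
  conjugate-· g h x = begin
    (g · ((h · x) · (h ⁻¹))) · (g ⁻¹)  ≡⟨ cong (_· (g ⁻¹)) (assoc g (h · x) (h ⁻¹)) ⟨
    ((g · (h · x)) · (h ⁻¹)) · (g ⁻¹)  ≡⟨ assoc (g · (h · x)) (h ⁻¹) (g ⁻¹) ⟩
    (g · (h · x)) · ((h ⁻¹) · (g ⁻¹))  ≡⟨ cong₂ _·_ (assoc g h x) (⁻¹-anti-homo-∙ g h) ⟨
    ((g · h) · x) · ((g · h) ⁻¹)       ∎
    where open ≡-Reasoning

  conjugate-self : ∀ g → conjugate g g ≡ g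
  conjugate-self g = //-rightDividesʳ g g

  conjugate-injective : ∀ g {x y} → conjugate g x ≡ conjugate g y → x ≡ y
  conjugate-injective g p = ∙-cancelˡ g _ _ (∙-cancelʳ (g ⁻¹) _ _ p)

  conjugate-involutive : ∀ g {x} → x · x ≡ e → conjugate g x ⁻¹ ≡ conjugate g x
  conjugate-involutive g {x} xx≡e = sym (inverseʳ-unique (conjugate g x) (conjugate g x) (begin
    conjugate g x · ((g · x) · (g ⁻¹))  ≡⟨ assoc (conjugate g x) (g · x) (g ⁻¹) ⟨
    (conjugate g x · (g · x)) · (g ⁻¹)  ≡⟨ cong (_· (g ⁻¹)) (conjugate-act g x x) ⟩
    (g · (x · x)) · (g ⁻¹)              ≡⟨ cong (λ y → (g · y) · (g ⁻¹)) xx≡e ⟩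
    (g · e) · (g ⁻¹)                    ≡⟨ cong (_· (g ⁻¹)) (identityʳ g) ⟩
    g · (g ⁻¹)                          ≡⟨ inverseʳ g ⟩
    e                                   ∎))
    where open ≡-Reasoning

  crossings : (Fin N → Bool) → Fin N → ℕ
  crossings χ g = ∑[ a < N ] 𝟙[ χ a ∧ not (χ (g · a)) ]

  crossings-e : ∀ χ → crossings χ e ≡ 0
  crossings-e χ = trans (sum-cong-≗ no-crossing) (sum-replicate-zero N)
    where
    no-crossing : ∀ a → 𝟙[ χ a ∧ not (χ (e · a)) ] ≡ 0
    no-crossing a =
      trans (cong (λ b → 𝟙[ χ a ∧ not (χ b) ]) (identityˡ a)) (cong 𝟙[_] (∧-inverseʳ (χ a)))

  crossings-· : ∀ χ g h → crossings χ (g · h) ≤ crossings χ g + crossings (χ ∘ (g ·_)) h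
  crossings-· χ g h = begin
    ∑[ a < N ] 𝟙[ χ a ∧ not (χ ((g · h) · a)) ]
      ≡⟨ sum-cong-≗ (λ a → cong (λ b → 𝟙[ χ a ∧ not (χ b) ]) (assoc g h a)) ⟩
    ∑[ a < N ] 𝟙[ χ a ∧ not (χ (g · (h · a))) ]
      ≤⟨ ∑-mono-≤ (λ a → 𝟙[∧not]-trans (χ a) (χ (g · a)) (χ (g · (h · a)))) ⟩
    ∑[ a < N ] (𝟙[ χ a ∧ not (χ (g · a)) ] + 𝟙[ χ (g · a) ∧ not (χ (g · (h · a))) ])
      ≡⟨ ∑-distrib-+ (λ a → 𝟙[ χ a ∧ not (χ (g · a)) ])
                     (λ a → 𝟙[ χ (g · a) ∧ not (χ (g · (h · a))) ]) ⟩
    crossings χ g + crossings (χ ∘ (g ·_)) h ∎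
    where open ≤-Reasoning

  crossings-conjugate : ∀ χ g h → crossings (χ ∘ (g ·_)) h ≡ crossings χ (conjugate g h)
  crossings-conjugate χ g h = begin
    ∑[ a < N ] 𝟙[ χ (g · a) ∧ not (χ (g · (h · a))) ]
      ≡⟨ sum-cong-≗ (λ a → cong (λ b → 𝟙[ χ (g · a) ∧ not (χ b) ]) (conjugate-act g h a)) ⟨
    ∑[ a < N ] 𝟙[ χ (g · a) ∧ not (χ (conjugate g h · (g · a))) ]
      ≡⟨ ∑-translateˡ g (λ b → 𝟙[ χ b ∧ not (χ (conjugate g h · b)) ]) ⟩
    crossings χ (conjugate g h) ∎
    where open ≡-Reasoning

  ∑-crossings : ∀ χ → ∑[ g < N ] crossings χ g ≡ ∑[ a < N ] ∑[ b < N ] 𝟙[ χ a ∧ not (χ b) ]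
  ∑-crossings χ = trans (∑-comm (λ g a → 𝟙[ χ a ∧ not (χ (g · a)) ]))
                        (sum-cong-≗ (λ a → ∑-translateʳ a (λ b → 𝟙[ χ a ∧ not (χ b) ])))

module CoxeterSystem (W : FiniteCoxeterSystem) where

  open FiniteCoxeterSystem W
  open IsGroup isGroup using (assoc; identityˡ; identityʳ; inverseʳ)
  open FiniteGroup isGroup

  gen-involutive : ∀ s → gen s · gen s ≡ e
  gen-involutive s = trans (cong (gen s ·_) (sym (identityʳ (gen s)))) relator-ss
    where
    relator-ss : eval (concat (replicate 1 (s ∷ s ∷ []))) ≡ e
    relator-ss = subst (λ k → eval (concat (replicate k (s ∷ s ∷ []))) ≡ e) (m-diag s) (relations s s)

  gen-cancel : ∀ s y → gen s · (gen s · y) ≡ y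
  gen-cancel s y = begin
    gen s · (gen s · y)  ≡⟨ assoc (gen s) (gen s) y ⟨
    (gen s · gen s) · y  ≡⟨ cong (_· y) (gen-involutive s) ⟩
    e · y                ≡⟨ identityˡ y ⟩
    y                    ∎
    where open ≡-Reasoning

  eval-++ : ∀ u v → eval (u ++ v) ≡ eval u · eval v
  eval-++ []      v = sym (identityˡ (eval v))
  eval-++ (s ∷ u) v = trans (cong (gen s ·_) (eval-++ u v)) (sym (assoc (gen s) (eval u) (eval v)))

  parity-length-++ : ∀ (u v : Word rank) →
    parity (length (u ++ v)) ≡ parity (length u) +ℙ parity (length v)
  parity-length-++ u v = trans (cong parity (length-++ u)) (ℙ.+-homo-+ (length u) (length v))

  relator-even : ∀ i j → parity (length (relator m i j)) ≡ 0ℙ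
  relator-even i j = repetition-even (m i j)
    where
    repetition-even : ∀ k → parity (length (concat (replicate k (i ∷ j ∷ [])))) ≡ 0ℙ
    repetition-even zero    = refl
    repetition-even (suc k) = repetition-even k

  ∼-parity : ∀ {u v} → u ∼[ m ] v → parity (length u) ≡ parity (length v)
  ∼-parity (∼-rel u v i j) = begin
    parity (length (u ++ relator m i j ++ v))
      ≡⟨ parity-length-++ u (relator m i j ++ v) ⟩
    parity (length u) +ℙ parity (length (relator m i j ++ v))
      ≡⟨ cong (parity (length u) +ℙ_) (parity-length-++ (relator m i j) v) ⟩
    parity (length u) +ℙ (parity (length (relator m i j)) +ℙ parity (length v))
      ≡⟨ cong (λ p → parity (length u) +ℙ (p +ℙ parity (length v))) (relator-even i j) ⟩
    parity (length u) +ℙ parity (length v)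
      ≡⟨ parity-length-++ u v ⟨
    parity (length (u ++ v)) ∎
    where open ≡-Reasoning
  ∼-parity ∼-refl        = refl
  ∼-parity (∼-sym p)     = sym (∼-parity p)
  ∼-parity (∼-trans p q) = trans (∼-parity p) (∼-parity q)

  eval≡e⇒even : ∀ u → eval u ≡ e → parity (length u) ≡ 0ℙ
  eval≡e⇒even u u≡e = ∼-parity (presentation u u≡e)

  -- The presentation only speaks about words for e, so both words are completed by a word for
  -- the inverse of their common value.
  eval-parity : ∀ u v → eval u ≡ eval v → parity (length u) ≡ parity (length v)
  eval-parity u v u≡v = ℙ.+-cancelʳ-≡ (parity (length q)) _ _ (begin
    parity (length u) +ℙ parity (length q)  ≡⟨ parity-length-++ u q ⟨
    parity (length (u ++ q))                ≡⟨ even u u≡v ⟩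
    0ℙ                                      ≡⟨ even v refl ⟨
    parity (length (v ++ q))                ≡⟨ parity-length-++ v q ⟩
    parity (length v) +ℙ parity (length q)  ∎)
    where
    open ≡-Reasoning
    q = proj₁ (generates (eval v ⁻¹))
    even : ∀ w → eval w ≡ eval v → parity (length (w ++ q)) ≡ 0ℙ
    even w w≡v = eval≡e⇒even (w ++ q)
      (trans (eval-++ w q) (trans (cong₂ _·_ w≡v (proj₂ (generates (eval v ⁻¹)))) (inverseʳ (eval v))))

  Reflection : Fin N → Set
  Reflection t = ∃₂ λ g i → conjugate g (gen i) ≡ t

  reflection-involutive : ∀ {t} → Reflection t → t ⁻¹ ≡ t
  reflection-involutive (g , i , refl) = conjugate-involutive g (gen-involutive i)

  isReflection-complete : ∀ {t} → Reflection t → isReflection W t ≡ true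
  isReflection-complete (g , i , refl) = Equivalence.to T-≡
    (any⁺ _ (lose (∈-allFin g) (any⁺ _ (lose (∈-allFin i) (fromWitness refl)))))

  -- For u = s₁⋯s_k this lists t_j = s₁⋯s_{j-1} s_j s_{j-1}⋯s₁, and t_j · eval u is eval u
  -- with the j-th letter deleted.
  reflections : Word rank → List (Fin N)
  reflections []      = []
  reflections (s ∷ u) = gen s ∷ map (conjugate (gen s)) (reflections u)

  reflections-reflection : ∀ u → All Reflection (reflections u)
  reflections-reflection []      = []
  reflections-reflection (s ∷ u) =
    (gen s , s , conjugate-self (gen s)) ∷
    All.map⁺ (All.map (λ { (g , i , refl) → gen s · g , i , sym (conjugate-· (gen s) g (gen i)) })
                      (reflections-reflection u))

  ShortensBy : Word rank → Fin N → Set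
  ShortensBy u t = ∃ λ w → length w < length u × eval w ≡ t · eval u

  reflections-shorten : ∀ u → All (ShortensBy u) (reflections u)
  reflections-shorten []      = []
  reflections-shorten (s ∷ u) =
    (u , n<1+n (length u) , sym (gen-cancel s (eval u))) ∷
    All.map⁺ (All.map (λ { {t} (w , |w|<|u| , w≡tu) →
                          s ∷ w , s≤s |w|<|u| ,
                          trans (cong (gen s ·_) w≡tu) (sym (conjugate-act (gen s) t (eval u))) })
                      (reflections-shorten u))

  Reduced : Word rank → Set
  Reduced u = ∀ v → eval v ≡ eval u → length u ≤ length v

  reflections-unique : ∀ {u} → Reduced u → Unique (reflections u)
  reflections-unique {[]}    _       = []
  reflections-unique {s ∷ u} reduced =
    All.map⁺ (All.map gen-not-conjugate (reflections-shorten u)) ∷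
    Unique.map⁺ (conjugate-injective (gen s)) (reflections-unique reducedᵘ)
    where
    reducedᵘ : Reduced u
    reducedᵘ v v≡u = s≤s⁻¹ (reduced (s ∷ v) (cong (gen s ·_) v≡u))
    gen-not-conjugate : ∀ {t} → ShortensBy u t → gen s ≢ conjugate (gen s) t
    gen-not-conjugate {t} (w , |w|<|u| , w≡tu) s≡sts =
      <⇒≱ (m<n⇒m<1+n |w|<|u|) (reduced w (trans w≡tu (cong (_· eval u) t≡s)))
      where
      t≡s : t ≡ gen s
      t≡s = conjugate-injective (gen s) (trans (sym s≡sts) (sym (conjugate-self (gen s))))

  crossings-eval-≤ : ∀ χ u → crossings χ (eval u) ≤ sum (map (crossings χ) (reflections u))
  crossings-eval-≤ χ []      = ≤-reflexive (crossings-e χ)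
  crossings-eval-≤ χ (s ∷ u) = begin
    crossings χ (gen s · eval u)
      ≤⟨ crossings-· χ (gen s) (eval u) ⟩
    crossings χ (gen s) + crossings (χ ∘ (gen s ·_)) (eval u)
      ≤⟨ +-monoʳ-≤ (crossings χ (gen s)) (crossings-eval-≤ (χ ∘ (gen s ·_)) u) ⟩
    crossings χ (gen s) + sum (map (crossings (χ ∘ (gen s ·_))) (reflections u))
      ≡⟨ cong (λ xs → crossings χ (gen s) + sum xs)
              (trans (map-cong (crossings-conjugate χ (gen s)) (reflections u)) (map-∘ (reflections u))) ⟩
    crossings χ (gen s) + sum (map (crossings χ) (map (conjugate (gen s)) (reflections u))) ∎
    where open ≤-Reasoning

  module WordLength (ℓ : Fin N → ℕ) (isWordLength : IsWordLength W ℓ) where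

    sign : Fin N → Parity
    sign w = parity (ℓ w)

    sign-eval : ∀ u → sign (eval u) ≡ parity (length u)
    sign-eval u with proj₁ (isWordLength (eval u))
    ... | u′ , |u′|≡ℓ , u′≡u = trans (cong parity (sym |u′|≡ℓ)) (eval-parity u′ u u′≡u)

    sign-· : ∀ g h → sign (g · h) ≡ sign g +ℙ sign h
    sign-· g h with generates g | generates h
    ... | u , refl | v , refl = begin
      sign (eval u · eval v)                  ≡⟨ cong sign (eval-++ u v) ⟨
      sign (eval (u ++ v))                    ≡⟨ sign-eval (u ++ v) ⟩
      parity (length (u ++ v))                ≡⟨ parity-length-++ u v ⟩
      parity (length u) +ℙ parity (length v)  ≡⟨ cong₂ _+ℙ_ (sign-eval u) (sign-eval v) ⟨
      sign (eval u) +ℙ sign (eval v)          ∎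
      where open ≡-Reasoning

    sign-conjugate : ∀ g x → sign (conjugate g x) ≡ sign x
    sign-conjugate g x = begin
      sign ((g · x) · (g ⁻¹))               ≡⟨ sign-· (g · x) (g ⁻¹) ⟩
      sign (g · x) +ℙ sign (g ⁻¹)           ≡⟨ cong (_+ℙ sign (g ⁻¹)) (sign-· g x) ⟩
      (sign g +ℙ sign x) +ℙ sign (g ⁻¹)     ≡⟨ cong (_+ℙ sign (g ⁻¹)) (ℙ.+-comm (sign g) (sign x)) ⟩
      (sign x +ℙ sign g) +ℙ sign (g ⁻¹)     ≡⟨ ℙ.+-assoc (sign x) (sign g) (sign (g ⁻¹)) ⟩
      sign x +ℙ (sign g +ℙ sign (g ⁻¹))     ≡⟨ cong (sign x +ℙ_) (sign-· g (g ⁻¹)) ⟨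
      sign x +ℙ sign (g · (g ⁻¹))           ≡⟨ cong (λ y → sign x +ℙ sign y) (inverseʳ g) ⟩
      sign x +ℙ sign e                      ≡⟨ cong (sign x +ℙ_) (sign-eval []) ⟩
      sign x +ℙ 0ℙ                          ≡⟨ ℙ.+-identityʳ (sign x) ⟩
      sign x                                ∎
      where open ≡-Reasoning

    sign-reflection : ∀ {t} → Reflection t → sign t ≡ 1ℙ
    sign-reflection (g , i , refl) =
      trans (sign-conjugate g (gen i)) (trans (cong sign (sym (identityʳ (gen i)))) (sign-eval (i ∷ [])))

    ℓ-reflection-≢ : ∀ {t} → Reflection t → ∀ y → ℓ (t · y) ≢ ℓ y
    ℓ-reflection-≢ {t} r y ℓty≡ℓy = ℙ.p≢p⁻¹ (sign y) (begin
      sign y            ≡⟨ cong parity ℓty≡ℓy ⟨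
      sign (t · y)      ≡⟨ sign-· t y ⟩
      sign t +ℙ sign y  ≡⟨ cong (_+ℙ sign y) (sign-reflection r) ⟩
      sign y ⁻¹ℙ        ∎)
      where open ≡-Reasoning

    bruhatAdj-reflection : ∀ {t} → Reflection t → ∀ y → bruhatAdj W ℓ y (t · y) ≡ true
    bruhatAdj-reflection {t} r y
      rewrite //-rightDividesʳ y t
            | ⁻¹-anti-homo-∙ t y
            | \\-leftDividesˡ y (t ⁻¹)
            | reflection-involutive r
            | isReflection-complete r
      = ≢⇒<?∨>? (ℓ-reflection-≢ r y)

    edge : Subset N → Fin N → Fin N → ℕ
    edge A y v = 𝟙[ lookup A y ∧ not (lookup A v) ∧ bruhatAdj W ℓ y v ]

    boundarySize≡∑∑edge : ∀ A → boundarySize W ℓ A ≡ ∑[ y < N ] ∑[ v < N ] edge A y v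
    boundarySize≡∑∑edge A = trans (sum-map-allFin (λ y → sum (map (edge A y) (allFin N))))
                                  (sum-cong-≗ (λ y → sum-map-allFin (edge A y)))

    crossings-reflection : ∀ A {t} → Reflection t → crossings (lookup A) t ≡ ∑[ y < N ] edge A y (t · y)
    crossings-reflection A {t} r = sum-cong-≗ λ y → cong (λ b → 𝟙[ lookup A y ∧ b ]) (begin
      not (lookup A (t · y))                            ≡⟨ ∧-identityʳ _ ⟨
      not (lookup A (t · y)) ∧ true                     ≡⟨ cong (_ ∧_) (bruhatAdj-reflection r y) ⟨
      not (lookup A (t · y)) ∧ bruhatAdj W ℓ y (t · y)  ∎)
      where open ≡-Reasoning

    ∑-reflection-edges≤∑-edges : ∀ A {u} → Reduced u → ∀ y →
      sum (map (λ t → edge A y (t · y)) (reflections u)) ≤ ∑[ v < N ] edge A y v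
    ∑-reflection-edges≤∑-edges A {u} reduced y =
      subst (_≤ ∑[ v < N ] edge A y v) (cong sum (sym (map-∘ {g = edge A y} {f = _· y} (reflections u))))
            (sum-map-≤-∑ (edge A y) (Unique.map⁺ (∙-cancelʳ y _ _) (reflections-unique {u} reduced)))

    crossings≤boundarySize : ∀ A g → crossings (lookup A) g ≤ boundarySize W ℓ A
    crossings≤boundarySize A g with isWordLength g
    ... | (u , |u|≡ℓ , refl) , minimal = begin
      crossings (lookup A) (eval u)
        ≤⟨ crossings-eval-≤ (lookup A) u ⟩
      sum (map (crossings (lookup A)) R)
        ≡⟨ cong sum (map-cong-local (All.map (crossings-reflection A) (reflections-reflection u))) ⟩
      sum (map (λ t → ∑[ y < N ] edge A y (t · y)) R)
        ≡⟨ sum-map-∑-comm (λ t y → edge A y (t · y)) R ⟩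
      ∑[ y < N ] sum (map (λ t → edge A y (t · y)) R)
        ≤⟨ ∑-mono-≤ (∑-reflection-edges≤∑-edges A {u} reduced) ⟩
      ∑[ y < N ] ∑[ v < N ] edge A y v
        ≡⟨ boundarySize≡∑∑edge A ⟨
      boundarySize W ℓ A ∎
      where
      open ≤-Reasoning
      R = reflections u
      reduced : Reduced u
      reduced v v≡u = subst (_≤ length v) (sym |u|≡ℓ) (minimal v v≡u)

corollary4p2 : (W : FiniteCoxeterSystem) (ℓ : Fin (FiniteCoxeterSystem.N W) → ℕ) →
    IsWordLength W ℓ → (A : Subset (FiniteCoxeterSystem.N W)) →
    ∣ A ∣ * (FiniteCoxeterSystem.N W ∸ ∣ A ∣) ≤ 2 * boundarySize W ℓ A * FiniteCoxeterSystem.N W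
corollary4p2 W ℓ isWordLength A = begin
  ∣ A ∣ * (N ∸ ∣ A ∣)                                      ≡⟨ ∑∑𝟙[inside∧outside] A ⟨
  ∑[ a < N ] ∑[ b < N ] 𝟙[ lookup A a ∧ not (lookup A b) ] ≡⟨ ∑-crossings (lookup A) ⟨
  ∑[ g < N ] crossings (lookup A) g                        ≤⟨ ∑-mono-≤ (crossings≤boundarySize A) ⟩
  ∑[ g < N ] ∂A                                            ≡⟨ ∑-const N ∂A ⟩
  N * ∂A                                                   ≡⟨ *-comm N ∂A ⟩
  ∂A * N                                                   ≤⟨ *-monoˡ-≤ N (m≤m+n ∂A (∂A + 0)) ⟩
  2 * ∂A * N                                               ∎
  where
  open FiniteCoxeterSystem W using (N; isGroup)
  open FiniteGroup isGroup using (crossings; ∑-crossings)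
  open CoxeterSystem W using (module WordLength)
  open WordLength ℓ isWordLength using (crossings≤boundarySize)
  open ≤-Reasoning
  ∂A = boundarySize W ℓ A
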